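{- Run Algorithm 2 (Find-Switching-Flow-2, described in the context) on a G-ARRIVAL instance consisting of a switch graph $G=(V,E,s_0,s_1)$ with non-empty $T\subseteq V$ and starting tokens $(t^+_v)_{v\in T}$ with $t^+\ge1$, together with a smallest balanced separator $S$ of $G-T$, and assume $G$ has treewidth at most $k$. Then the algorithm cannot reach recursion depth $k+2$ without at least once recursing in a splitting case. Moreover, if a splitting case is reached, then each connected component $C\subseteq V\setminus(T\cup S)$ of $G-T-S$ satisfies $|C|\le\frac{|V\setminus T|}{2}$.
   Context: A switch graph is a directed multigraph $G=(V,E,s_0,s_1)$ with $s_0,s_1:V\to V$ and $E=\{(v,s_0(v))\}\cup\{(v,s_1(v))\}$; at least one terminal is reachable from every non-terminal; $t^+=\sum_{v\in T}t^+_v$. Treewidth and balanced separators refer to the underlying simple undirected graph; $S$ is a balanced separator of $H$ if every connected component of $H-S$ has at most half of the vertices of $H$. For a switching flow $x$, $x^-(p)$ denotes total flow on edges entering $p$. Algorithm 2, Find-Switching-Flow-2$(G,T,(t^+_v)_{v\in T},S)$: (Base case) if $T=V$, return $x$ with $x(v,s_0(v))=\lceil t^+_v/2\rceil$, $x(v,s_1(v))=\lfloor t^+_v/2\rfloor$. (Binary search case) Else if $S\neq\emptyset$: pick any $p\in S$, $T'=T\cup\{p\}$, $S'=S\setminus\{p\}$, $\ell=0$, $r=2^{|V|}t^+$; while $\ell<r$: $t^+_p=\lceil(\ell+r)/2\rceil$, $x$ = recursive call on $(G,T',(t^+_v)_{v\in T'},S')$; if $x^-(p)<t^+_p$ set $r=t^+_p-1$;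 if equal return $x$; if $x^-(p)>t^+_p$ set $\ell=t^+_p+1$. (Splitting case) Else ($S=\emptyset$, $T\ne V$): for every connected component $C$ of (undirected) $G-T$, let $G_C$ be obtained from $G$ by removing vertices not in $C\cup T$ and their outgoing edges and replacing edges leaving $C\cup T$ by self-loops; find a smallest balanced separator $S_C\subseteq C$ of $G_C-T$; recursively call on $(G_C,T,(t^+_v)_{v\in T},S_C)$; combine the resulting flows edgewise and return. -}

module Defs where

open import Data.Nat using (ℕ; zero; suc; _+_; _*_; _^_; _≤_)
open import Data.Fin using (Fin; zero; suc; toℕ; _≟_)
open import Data.Fin.Subset using (Subset; _∈_; _∉_; _⊆_; _∪_; _─_; _-_; ⁅_⁆; ∣_∣; Nonempty)
open import Data.Fin.Subset.Properties using (_∈?_)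
open import Data.Vec.Base using (sum; tabulate)
open import Data.Bool using (if_then_else_)
open import Data.Product using (Σ; ∃; _×_; _,_)
open import Data.Sum using (_⊎_)
open import Relation.Nullary using (¬_; does)
open import Relation.Binary.PropositionalEquality using (_≡_)
open import Relation.Binary.Construct.Closure.ReflexiveTransitive using (Star)

InducedEdge : ∀ {n} → (Fin n → Fin n → Set) → Subset n → Fin n → Fin n → Set
InducedEdge Adj X u v = u ∈ X × v ∈ X × Adj u v

ConnectedIn : ∀ {n} → (Fin n → Fin n → Set) → Subset n → Fin n → Fin n → Set
ConnectedIn Adj X u v = u ∈ X × Star (InducedEdge Adj X) u v

IsComponent : ∀ {n} → (Fin n → Fin n → Set) → Subset n → Subset n → Set
IsComponent Adj X C =
  C ⊆ X × Nonempty C ×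
  (∀ u v → u ∈ C → v ∈ X → (v ∈ C → ConnectedIn Adj X u v) × (ConnectedIn Adj X u v → v ∈ C))

BalancedSeparator : ∀ {n} → (Fin n → Fin n → Set) → Subset n → Subset n → Set
BalancedSeparator Adj X S =
  S ⊆ X × (∀ C → IsComponent Adj (X ─ S) C → 2 * ∣ C ∣ ≤ ∣ X ∣)

SmallestBalancedSeparator : ∀ {n} → (Fin n → Fin n → Set) → Subset n → Subset n → Set
SmallestBalancedSeparator Adj X S =
  BalancedSeparator Adj X S × (∀ S′ → BalancedSeparator Adj X S′ → ∣ S ∣ ≤ ∣ S′ ∣)

-- The decomposition tree has node set Fin (suc m); node (suc i) is joined
-- to its parent  parent i , whose index is at most i (every finite tree
-- admits such a labelling, e.g. in BFS order).

TreeAdj : ∀ {m} → (Fin m → Fin (suc m)) → Fin (suc m) → Fin (suc m) → Set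
TreeAdj {m} parent a b =
  Σ (Fin m) λ i → (a ≡ suc i × b ≡ parent i) ⊎ (b ≡ suc i × a ≡ parent i)

record TreeDecomposition {n : ℕ} (Adj : Fin n → Fin n → Set) (k : ℕ) : Set where
  field
    m          : ℕ
    parent     : Fin m → Fin (suc m)
    parent<    : ∀ i → toℕ (parent i) ≤ toℕ i
    bag        : Fin (suc m) → Subset n
    covers     : ∀ v → ∃ λ a → v ∈ bag a
    edgeCover  : ∀ u v → Adj u v → ∃ λ a → u ∈ bag a × v ∈ bag a
    coherent   : ∀ v a b → v ∈ bag a → v ∈ bag b →
                 Star (λ x y → v ∈ bag x × v ∈ bag y × TreeAdj parent x y) a b
    width      : ∀ a → ∣ bag a ∣ ≤ suc k

TreewidthAtMost : ∀ {n} → ℕ → (Fin n → Fin n → Set) → Set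
TreewidthAtMost k Adj = TreeDecomposition Adj k

-- underlying simple undirected graph: loops dropped, parallel edges merged
UAdj : ∀ {n} → (Fin n → Fin n) → (Fin n → Fin n) → Fin n → Fin n → Set
UAdj s₀ s₁ u v = ¬ (u ≡ v) × (s₀ u ≡ v ⊎ s₁ u ≡ v ⊎ s₀ v ≡ u ⊎ s₁ v ≡ u)

DEdge : ∀ {n} → (Fin n → Fin n) → (Fin n → Fin n) → Fin n → Fin n → Set
DEdge s₀ s₁ u v = s₀ u ≡ v ⊎ s₁ u ≡ v

TerminalReachable : ∀ {n} → (Fin n → Fin n) → (Fin n → Fin n) → Subset n → Set
TerminalReachable s₀ s₁ T = ∀ v → ∃ λ u → u ∈ T × Star (DEdge s₀ s₁) v u

tplus : ∀ {n} → Subset n → (Fin n → ℕ) → ℕ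
tplus T t = sum (tabulate λ v → if does (v ∈? T) then t v else 0)

-- Arguments of a (recursive) call of Find-Switching-Flow-2.
-- The current graph has vertex set  active ⊆ Fin n  (vertices outside it
-- have been removed by earlier splitting steps).

record Config (n : ℕ) : Set where
  constructor config
  field
    active : Subset n
    s₀ s₁  : Fin n → Fin n
    T      : Subset n
    tok    : Fin n → ℕ
    S      : Subset n
open Config public

NotBase : ∀ {n} → Config n → Set
NotBase c = ∃ λ v → v ∈ active c × v ∉ T c

SplittingCase : ∀ {n} → Config n → Set
SplittingCase c = (∀ v → v ∉ S c) × NotBase c

-- One recursive call made in the binary search case: some p ∈ S is made a
-- terminal with some token count t⁺_p (a binary-search midpoint, hence in
-- [0, 2^|V| t⁺]) and removed from S.
data BinStep {n : ℕ} : Config n → Config n → Set where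
  bin : ∀ {c} (p : Fin n) (tp : ℕ) → NotBase c → p ∈ S c →
        tp ≤ 2 ^ ∣ active c ∣ * tplus (T c) (tok c) →
        BinStep c (config (active c) (s₀ c) (s₁ c) (T c ∪ ⁅ p ⁆)
                          (λ v → if does (v ≟ p) then tp else tok c v)
                          (S c - p))

data BinChain {n : ℕ} : ℕ → Config n → Config n → Set where
  here  : ∀ {c} → BinChain zero c c
  there : ∀ {d c c′ c″} → BinStep c c′ → BinChain d c′ c″ → BinChain (suc d) c c″

-- Every call in the binary search case moves one vertex of S into T, so a
-- chain of such calls has length at most |S|.  A graph of treewidth at most k
-- has, on every vertex set X, a balanced separator of size at most k + 1:
-- root the decomposition tree and take X ∩ (bag of a deepest node whose
-- subtree carries more than half of X).  Since S is a smallest balanced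
-- separator of G - T, |S| ≤ k + 1 and no chain reaches depth k + 2.  The
-- components of G - T - S are those of (G - T) - S, which S balances.
module Submission where

open import Defs
open import Data.Nat using (ℕ; _+_; _*_; _≤_)
open import Data.Fin using (Fin)
open import Data.Fin.Subset using (Subset; ⊤; ∁; _∪_; ∣_∣; Nonempty)
open import Data.Product using (_×_)
open import Relation.Nullary using (¬_)

open import Data.Nat using (zero; suc; _<_; z≤n; s≤s; _<?_)
import Data.Nat.Properties as ℕ
open import Data.Fin using (toℕ; _≟_) renaming (zero to fz; suc to fs)
import Data.Fin.Properties as Fin
open import Data.Fin.Subset using (_∈_; _∉_; _⊆_; _─_; _∩_; inside; outside)
open import Data.Fin.Subset.Properties
  using (_∈?_; x∈p∩q⁺; p⊆q⇒∣p∣≤∣q∣; x∈p⇒∣p-x∣<∣p∣; ∣p∩q∣≤∣q∣; p∩q⊆p; p─q⊆p; drop-∷-⊆)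
open import Data.Vec using ([]; _∷_; tabulate; here; there)
open import Data.Vec.Properties using (lookup∘tabulate; []=⇒lookup; lookup⇒[]=)
open import Data.Product using (∃; _,_; proj₁; proj₂)
open import Data.Sum using (_⊎_; inj₁; inj₂)
open import Data.Empty using (⊥-elim)
open import Function using (_∘_)
open import Relation.Nullary using (Dec; yes; no; does)
open import Relation.Nullary.Decidable using (_×-dec_)
open import Relation.Unary using (Pred; Decidable)
open import Relation.Binary.PropositionalEquality
  using (_≡_; _≢_; refl; sym; trans; cong; subst)
open import Relation.Binary.Construct.Closure.ReflexiveTransitive using (Star; ε; _◅_)

x∈p─q⇒x∉q : ∀ {n} {p q : Subset n} {x} → x ∈ p ─ q → x ∉ q
x∈p─q⇒x∉q {p = _ ∷ _} {outside ∷ _} here        ()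
x∈p─q⇒x∉q {p = _ ∷ _} {_ ∷ _}       (there x∈) (there x∈q) = x∈p─q⇒x∉q x∈ x∈q

∁[p∪q]≡∁p─q : ∀ {n} (p q : Subset n) → ∁ (p ∪ q) ≡ ∁ p ─ q
∁[p∪q]≡∁p─q []            []            = refl
∁[p∪q]≡∁p─q (inside  ∷ p) (inside  ∷ q) = cong (outside ∷_) (∁[p∪q]≡∁p─q p q)
∁[p∪q]≡∁p─q (inside  ∷ p) (outside ∷ q) = cong (outside ∷_) (∁[p∪q]≡∁p─q p q)
∁[p∪q]≡∁p─q (outside ∷ p) (inside  ∷ q) = cong (outside ∷_) (∁[p∪q]≡∁p─q p q)
∁[p∪q]≡∁p─q (outside ∷ p) (outside ∷ q) = cong (inside ∷_) (∁[p∪q]≡∁p─q p q)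

disjoint⇒∣p∣+∣q∣≤∣r∣ : ∀ {n} (p q r : Subset n) → p ⊆ r → q ⊆ r →
                       (∀ {x} → x ∈ p → x ∉ q) → ∣ p ∣ + ∣ q ∣ ≤ ∣ r ∣
disjoint⇒∣p∣+∣q∣≤∣r∣ [] [] [] _ _ _ = z≤n
disjoint⇒∣p∣+∣q∣≤∣r∣ (x ∷ p) (y ∷ q) (z ∷ r) p⊆r q⊆r disj
  with disjoint⇒∣p∣+∣q∣≤∣r∣ p q r (drop-∷-⊆ p⊆r) (drop-∷-⊆ q⊆r) (λ x∈p x∈q → disj (there x∈p) (there x∈q))
... | ih with x | y | z
... | inside  | inside  | _       = ⊥-elim (disj here here)
... | inside  | outside | inside  = s≤s ih
... | inside  | outside | outside with () ← p⊆r here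
... | outside | inside  | inside  = subst (_≤ suc ∣ r ∣) (sym (ℕ.+-suc ∣ p ∣ ∣ q ∣)) (s≤s ih)
... | outside | inside  | outside with () ← q⊆r here
... | outside | outside | inside  = ℕ.m≤n⇒m≤1+n ih
... | outside | outside | outside = ih

module _ {ℓ} {n : ℕ} {P : Pred (Fin n) ℓ} (P? : Decidable P) where

  subsetOf : Subset n
  subsetOf = tabulate (does ∘ P?)

  ∈-subsetOf⁺ : ∀ {x} → P x → x ∈ subsetOf
  ∈-subsetOf⁺ {x} px = lookup⇒[]= x subsetOf (trans (lookup∘tabulate (does ∘ P?) x) (does-true (P? x) px))
    where
    does-true : (d : Dec (P x)) → P x → does d ≡ inside
    does-true (yes _) _  = refl
    does-true (no ¬p) px = ⊥-elim (¬p px)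

  ∈-subsetOf⁻ : ∀ {x} → x ∈ subsetOf → P x
  ∈-subsetOf⁻ {x} x∈ with P? x | trans (sym (lookup∘tabulate (does ∘ P?) x)) ([]=⇒lookup x∈)
  ... | yes px | _ = px

noneOrLast : ∀ {ℓ} {N} {P : Pred (Fin N) ℓ} → Decidable P →
             (∀ b → ¬ P b) ⊎ ∃ λ a → P a × (∀ b → toℕ a < toℕ b → ¬ P b)
noneOrLast {N = zero} P? = inj₁ λ ()
noneOrLast {N = suc N} P? with noneOrLast (P? ∘ fs)
... | inj₂ (a , pa , last) = inj₂ (fs a , pa , λ { fz () ; (fs b) (s≤s a<b) → last b a<b })
... | inj₁ none with P? fz
...   | yes p0 = inj₂ (fz , p0 , λ { fz () ; (fs b) _ → none b })
...   | no ¬p0 = inj₁ λ { fz → ¬p0 ; (fs b) → none b }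

m+n≤o∧o<2*n⇒2*m≤o : ∀ {m n o} → m + n ≤ o → o < 2 * n → 2 * m ≤ o
m+n≤o∧o<2*n⇒2*m≤o {m} {n} {o} m+n≤o o<2n = begin
  2 * m  ≡⟨ cong (m +_) (ℕ.+-identityʳ m) ⟩
  m + m  ≤⟨ ℕ.+-monoʳ-≤ m (ℕ.<⇒≤ m<n) ⟩
  m + n  ≤⟨ m+n≤o ⟩
  o      ∎
  where
  open ℕ.≤-Reasoning
  m<n : m < n
  m<n = ℕ.+-cancelʳ-< n m n (ℕ.≤-<-trans m+n≤o (subst (o <_) (cong (n +_) (ℕ.+-identityʳ n)) o<2n))

BinChain⇒d≤∣S∣ : ∀ {n d} {c c′ : Config n} → BinChain d c c′ → d ≤ ∣ S c ∣
BinChain⇒d≤∣S∣ here = z≤n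
BinChain⇒d≤∣S∣ (there (bin p _ _ p∈S _) chain) = ℕ.≤-trans (s≤s (BinChain⇒d≤∣S∣ chain)) (x∈p⇒∣p-x∣<∣p∣ p∈S)

module TreeDecompositionSeparator {n} {Adj : Fin n → Fin n → Set} {k} (D : TreeDecomposition Adj k) where
  open TreeDecomposition D

  Node : Set
  Node = Fin (suc m)

  data _≼_ (z : Node) : Node → Set where
    ≼-refl  : z ≼ z
    ≼-child : ∀ i → z ≼ parent i → z ≼ fs i

  ≼-dec : ∀ z b → Dec (z ≼ b)
  ≼-dec z b = go (suc (toℕ b)) b ℕ.≤-refl
    where
    go : ∀ fuel b → toℕ b < fuel → Dec (z ≼ b)
    go (suc fuel) b _ with b ≟ z
    ... | yes refl = yes ≼-refl
    go (suc fuel) fz     _              | no b≢z = no λ { ≼-refl → b≢z refl }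
    go (suc fuel) (fs i) (s≤s i<fuel) | no b≢z with go fuel (parent i) (ℕ.≤-<-trans (parent< i) i<fuel)
    ... | yes z≼p = yes (≼-child i z≼p)
    ... | no z⋠p  = no λ { ≼-refl → b≢z refl ; (≼-child _ z≼p) → z⋠p z≼p }

  root≼ : ∀ b → fz ≼ b
  root≼ b = go (suc (toℕ b)) b ℕ.≤-refl
    where
    go : ∀ fuel b → toℕ b < fuel → fz ≼ b
    go (suc fuel) fz     _            = ≼-refl
    go (suc fuel) (fs i) (s≤s i<fuel) = ≼-child i (go fuel (parent i) (ℕ.≤-<-trans (parent< i) i<fuel))

  Below : Node → Fin n → Set
  Below z v = ∃ λ b → z ≼ b × v ∈ bag b

  Below? : ∀ z → Decidable (Below z)
  Below? z v = Fin.any? (λ b → ≼-dec z b ×-dec (v ∈? bag b))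

  -- the tree edge from z to its parent joins no two bags containing v
  Avoids : Node → Fin n → Set
  Avoids z v = ∀ i → v ∈ bag (fs i) → v ∈ bag (parent i) → fs i ≢ z

  ≼-step : ∀ {z p q} (e : TreeAdj parent p q) → fs (proj₁ e) ≢ z → z ≼ p → z ≼ q
  ≼-step (i , inj₁ (refl , refl)) fi≢z ≼-refl          = ⊥-elim (fi≢z refl)
  ≼-step (i , inj₁ (refl , refl)) _    (≼-child _ z≼p) = z≼p
  ≼-step (i , inj₂ (refl , refl)) _    z≼p             = ≼-child i z≼p

  Avoids⇒≼-closed : ∀ {z v a b} → Avoids z v → v ∈ bag a → v ∈ bag b → z ≼ a → z ≼ b
  Avoids⇒≼-closed {z} {v} {a} {b} avoids v∈a v∈b = along (coherent v a b v∈a v∈b)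
    where
    along : ∀ {p q} → Star (λ x y → v ∈ bag x × v ∈ bag y × TreeAdj parent x y) p q → z ≼ p → z ≼ q
    along ε z≼p = z≼p
    along ((v∈x , v∈y , e@(i , inj₁ (refl , refl))) ◅ path) = along path ∘ ≼-step e (avoids i v∈x v∈y)
    along ((v∈x , v∈y , e@(i , inj₂ (refl , refl))) ◅ path) = along path ∘ ≼-step e (avoids i v∈y v∈x)

  ≼-properChild : ∀ {a b} → a ≼ b → b ≢ a → ∃ λ j → parent j ≡ a × fs j ≼ b
  ≼-properChild ≼-refl b≢a = ⊥-elim (b≢a refl)
  ≼-properChild {a} (≼-child i a≼p) _ with parent i ≟ a
  ... | yes p≡a = i , p≡a , ≼-refl
  ... | no p≢a with ≼-properChild a≼p p≢a
  ...   | j , pj≡a , j≼p = j , pj≡a , ≼-child i j≼p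

  module _ (X : Subset n) where

    Down? : ∀ z → Decidable (λ v → v ∈ X × Below z v)
    Down? z v = v ∈? X ×-dec Below? z v

    Down : Node → Subset n
    Down z = subsetOf (Down? z)

    Heavy : Node → Set
    Heavy z = ∣ X ∣ < 2 * ∣ Down z ∣

    module _ (a : Node) where

      Sep : Subset n
      Sep = X ∩ bag a

      Rest : Subset n
      Rest = X ─ Sep

      ∈Rest⇒∉bag : ∀ {x} → x ∈ Rest → x ∉ bag a
      ∈Rest⇒∉bag x∈Rest x∈a = x∈p─q⇒x∉q x∈Rest (x∈p∩q⁺ (p─q⊆p X Sep x∈Rest , x∈a))

      Shielded : Node → Set
      Shielded z = ∀ w → w ∉ bag a → Avoids z w

      a-Shielded : Shielded a
      a-Shielded w w∉a i w∈i _ refl = w∉a w∈i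

      child-Shielded : ∀ j → parent j ≡ a → Shielded (fs j)
      child-Shielded j refl w w∉a i _ w∈pi refl = w∉a w∈pi

      Below-edge : ∀ {z x y b} → Shielded z → x ∈ Rest → x ∈ bag b → y ∈ bag b → Below z x → Below z y
      Below-edge shielded x∈Rest x∈b y∈b (b′ , z≼b′ , x∈b′) =
        _ , Avoids⇒≼-closed (shielded _ (∈Rest⇒∉bag x∈Rest)) x∈b′ x∈b z≼b′ , y∈b

      Below-path⁺ : ∀ {z x y} → Shielded z → Star (InducedEdge Adj Rest) x y → Below z x → Below z y
      Below-path⁺ _ ε = λ below → below
      Below-path⁺ shielded ((x∈Rest , _ , adj) ◅ path) with edgeCover _ _ adj
      ... | b , x∈b , y∈b = Below-path⁺ shielded path ∘ Below-edge shielded x∈Rest x∈b y∈b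

      Below-path⁻ : ∀ {z x y} → Shielded z → Star (InducedEdge Adj Rest) x y → Below z y → Below z x
      Below-path⁻ _ ε = λ below → below
      Below-path⁻ shielded ((_ , y∈Rest , adj) ◅ path) with edgeCover _ _ adj
      ... | b , x∈b , y∈b = Below-edge shielded y∈Rest y∈b x∈b ∘ Below-path⁻ shielded path

      module _ {C} (comp : IsComponent Adj Rest C) where

        path-in-C : ∀ {u v} → u ∈ C → v ∈ C → Star (InducedEdge Adj Rest) u v
        path-in-C {u} {v} u∈C v∈C = proj₂ (proj₁ (proj₂ (proj₂ comp) u v u∈C (proj₁ comp v∈C)) v∈C)

        component⊆Down : ∀ {z u} → Shielded z → u ∈ C → Below z u → C ⊆ Down z
        component⊆Down {z} shielded u∈C below v∈C =
          ∈-subsetOf⁺ (Down? z) (p─q⊆p X Sep (proj₁ comp v∈C) , Below-path⁺ shielded (path-in-C u∈C v∈C) below)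

        component-disjoint : ∀ {u} → u ∈ C → ¬ Below a u → ∀ {v} → v ∈ C → v ∉ Down a
        component-disjoint u∈C ¬below v∈C v∈Down =
          ¬below (Below-path⁻ a-Shielded (path-in-C u∈C v∈C) (proj₂ (∈-subsetOf⁻ (Down? a) v∈Down)))

      isBalanced : (∀ j → parent j ≡ a → ¬ Heavy (fs j)) → Heavy a ⊎ (∀ v → Below a v) →
                   BalancedSeparator Adj X Sep
      isBalanced light heavyOrAll = p∩q⊆p X (bag a) , λ C → bound C heavyOrAll
        where
        bound : ∀ C → Heavy a ⊎ (∀ v → Below a v) → IsComponent Adj Rest C → 2 * ∣ C ∣ ≤ ∣ X ∣
        bound C heavyOrAll comp@(C⊆Rest , (u , u∈C) , _) with Below? a u | heavyOrAll
        ... | yes (b , a≼b , u∈b) | _ =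
          let j , pj≡a , j≼b = ≼-properChild a≼b (λ { refl → ∈Rest⇒∉bag (C⊆Rest u∈C) u∈b }) in
          ℕ.≤-trans (ℕ.*-monoʳ-≤ 2 (p⊆q⇒∣p∣≤∣q∣ (component⊆Down comp (child-Shielded j pj≡a) u∈C (b , j≼b , u∈b))))
                    (ℕ.≮⇒≥ (light j pj≡a))
        ... | no ¬below | inj₂ all = ⊥-elim (¬below (all u))
        ... | no ¬below | inj₁ heavy = m+n≤o∧o<2*n⇒2*m≤o {n = ∣ Down a ∣}
          (disjoint⇒∣p∣+∣q∣≤∣r∣ C (Down a) X (p─q⊆p X Sep ∘ C⊆Rest) (proj₁ ∘ ∈-subsetOf⁻ (Down? a))
                                (component-disjoint comp u∈C ¬below))
          heavy

    -- a is the heavy node of largest index, so its children (larger indices) are light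
    balancedSeparator : ∃ λ S′ → BalancedSeparator Adj X S′ × ∣ S′ ∣ ≤ suc k
    balancedSeparator with noneOrLast (λ z → ∣ X ∣ <? 2 * ∣ Down z ∣)
    ... | inj₁ none = Sep fz ,
          isBalanced fz (λ j _ → none (fs j)) (inj₂ λ v → let b , v∈b = covers v in b , root≼ b , v∈b) ,
          ℕ.≤-trans (∣p∩q∣≤∣q∣ X (bag fz)) (width fz)
    ... | inj₂ (a , heavy , last) = Sep a ,
          isBalanced a (λ j pj≡a → last (fs j) (subst (λ p → toℕ p < suc (toℕ j)) pj≡a (s≤s (parent< j))))
                     (inj₁ heavy) ,
          ℕ.≤-trans (∣p∩q∣≤∣q∣ X (bag a)) (width a)

smallestBalancedSeparator≤treewidth+1 : ∀ {n k} {Adj : Fin n → Fin n → Set} {X S : Subset n} →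
  TreewidthAtMost k Adj → SmallestBalancedSeparator Adj X S → ∣ S ∣ ≤ suc k
smallestBalancedSeparator≤treewidth+1 {X = X} D (_ , smallest) =
  let S′ , balanced , ∣S′∣≤k+1 = TreeDecompositionSeparator.balancedSeparator D X in
  ℕ.≤-trans (smallest S′ balanced) ∣S′∣≤k+1

mainTheorem5 : ∀ {n} (s₀ s₁ : Fin n → Fin n) (T : Subset n) (t : Fin n → ℕ) (S : Subset n) (k : ℕ) →
    Nonempty T → TerminalReachable s₀ s₁ T → 1 ≤ tplus T t →
    SmallestBalancedSeparator (UAdj s₀ s₁) (∁ T) S →
    TreewidthAtMost k (UAdj s₀ s₁) →
    (∀ c → ¬ BinChain (k + 2) (config ⊤ s₀ s₁ T t S) c) ×
    (∀ d c → BinChain d (config ⊤ s₀ s₁ T t S) c → SplittingCase c →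
    ∀ C → IsComponent (UAdj s₀ s₁) (∁ (T ∪ S)) C → 2 * ∣ C ∣ ≤ ∣ ∁ T ∣)
-- The three hypotheses ignored here matter for the correctness of the algorithm, not for its recursion.
mainTheorem5 s₀ s₁ T t S k _ _ _ smallest D = noDeepChain , componentsBalanced
  where
  noDeepChain : ∀ c → ¬ BinChain (k + 2) (config ⊤ s₀ s₁ T t S) c
  noDeepChain c chain = ℕ.1+n≰n (subst (_≤ suc k) (ℕ.+-comm k 2)
    (ℕ.≤-trans (BinChain⇒d≤∣S∣ chain) (smallestBalancedSeparator≤treewidth+1 D smallest)))

  componentsBalanced : ∀ d c → BinChain d (config ⊤ s₀ s₁ T t S) c → SplittingCase c →
    ∀ C → IsComponent (UAdj s₀ s₁) (∁ (T ∪ S)) C → 2 * ∣ C ∣ ≤ ∣ ∁ T ∣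
  componentsBalanced _ _ _ _ C comp =
    proj₂ (proj₁ smallest) C (subst (λ Y → IsComponent (UAdj s₀ s₁) Y C) (∁[p∪q]≡∁p─q T S) comp)
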